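{- Let $S$ be a stable cut in an unweighted graph $G=(V,E)$ with $m$ edges and maximum degree $\Delta>2$, such that $\varphi(S)<(m-\Delta)/2$. Let $u$ be the (unique) critical vertex of $S$, and suppose $u\in S$. Assume that for every vertex $w\notin S$ with $x_S(w)=0$, the cut $S\oplus w$ is stable and satisfies $\varphi(S\oplus w)<(m-\Delta)/2$. Then there is a vertex $v$ with $x_S(v)=0$ such that $\varphi(S\oplus v)>\varphi(S)$.
   Context: For a cut $S\subseteq V$: $C_S$ is the number of edges crossing $S$; $d(v)$ the degree, $d_S(v)$ the number of crossing edges at $v$, $x_S(v)=d_S(v)-d(v)/2$ the excess. $S$ is stable if $d_S(v)>(d(v)-1)/2$ for all $v$. $S\oplus w$ is $S\setminus\{w\}$ if $w\in S$ and $S\cup\{w\}$ otherwise. $\varphi(S)=\min_{v\in V}C_{S-\{v\},G-\{v\}}$ where $G-\{v\}$ deletes $v$ and its incident edges; $v$ is critical for $S$ if $C_{S-\{v\},G-\{v\}}=\varphi(S)$. (Under the hypotheses $S$ stable and $\varphi(S)<(m-\Delta)/2$, the critical vertex is unique.) -}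

module Defs where

open import Data.Nat using (ℕ; zero; suc; _+_; _*_; _<_; _⊓_; _⊔_)
open import Data.Fin using (Fin; zero; suc; toℕ; _≟_)
open import Data.Bool using (Bool; true; false; if_then_else_; not; _∧_; _xor_)
open import Relation.Nullary.Decidable using (⌊_⌋)
open import Data.Nat.Properties using (_<?_)
open import Relation.Binary.PropositionalEquality using (_≡_)

record Graph (n : ℕ) : Set where
  field
    adj   : Fin n → Fin n → Bool
    sym   : ∀ i j → adj i j ≡ adj j i
    irrefl : ∀ i → adj i i ≡ false
open Graph public

Cut : ℕ → Set
Cut n = Fin n → Bool

count : ∀ {n} → (Fin n → Bool) → ℕ
count {zero}  p = 0
count {suc n} p = (if p zero then 1 else 0) + count {n} (λ i → p (suc i))

-- minimum / maximum of a function over Fin n (value 0 when n = 0)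
minFin : ∀ {n} → (Fin n → ℕ) → ℕ
minFin {zero} f = 0
minFin {suc zero} f = f zero
minFin {suc (suc n)} f = f zero ⊓ minFin {suc n} (λ i → f (suc i))

maxFin : ∀ {n} → (Fin n → ℕ) → ℕ
maxFin {zero} f = 0
maxFin {suc n} f = f zero ⊔ maxFin {n} (λ i → f (suc i))

-- number of unordered pairs {i,j} (i < j) satisfying a predicate
countPairs : ∀ {n} → (Fin n → Fin n → Bool) → ℕ
countPairs {zero}  q = 0
countPairs {suc k} q =
  count (λ j → ⌊ 0 <? toℕ j ⌋ ∧ q zero j) + countPairs {k} (λ i j → q (suc i) (suc j))

module _ {n : ℕ} (G : Graph n) where

  edges : ℕ
  edges = countPairs (adj G)

  deg : Fin n → ℕ
  deg v = count (adj G v)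

  maxDeg : ℕ
  maxDeg = maxFin deg

  degCut : Cut n → Fin n → ℕ
  degCut S v = count (λ w → adj G v w ∧ (S v xor S w))

  cutSize : Cut n → ℕ
  cutSize S = countPairs (λ i j → adj G i j ∧ (S i xor S j))

  cutSizeWithout : Cut n → Fin n → ℕ
  cutSizeWithout S v =
    countPairs (λ i j → not ⌊ i ≟ v ⌋ ∧ not ⌊ j ≟ v ⌋ ∧ adj G i j ∧ (S i xor S j))

  φ : Cut n → ℕ
  φ S = minFin (cutSizeWithout S)

  Critical : Cut n → Fin n → Set
  Critical S v = cutSizeWithout S v ≡ φ S

  -- S stable: d_S(v) > (d(v) - 1)/2, i.e. d(v) < 2 d_S(v) + 1, for all v
  Stable : Cut n → Set
  Stable S = ∀ v → deg v < 2 * degCut S v + 1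

  -- x_S(v) = 0, i.e. d_S(v) = d(v)/2, i.e. 2 d_S(v) = d(v)
  ZeroExcess : Cut n → Fin n → Set
  ZeroExcess S v = 2 * degCut S v ≡ deg v

  -- φ(S) < (m - Δ)/2, i.e. 2 φ(S) + Δ < m
  PhiSmall : Cut n → Set
  PhiSmall S = 2 * φ S + maxDeg < edges

_⊕_ : ∀ {n} → Cut n → Fin n → Cut n
(S ⊕ w) v = if ⌊ v ≟ w ⌋ then not (S v) else S v

module Submission where

-- Let D = d_S(u) and let E be the total excess 2 x_S away from u. Counting 4 C_S by degrees gives
-- 2m + Σ 2 x_S, and C_S = φ(S) + D, so φ(S) < (m − Δ)/2 forces E + Δ + 2 ≤ 2D: every other vertex
-- has cut degree below D, and the excess is nearly exhausted.
-- Suppose no zero-excess flip increases φ. Flipping a zero-excess vertex preserves C_S, so for a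
-- zero-excess cut neighbour v of u (one exists as E < D) the critical vertex w of S ⊕ v satisfies
-- d_{S⊕v}(w) ≥ D. Hence w is an uncut neighbour of v with d_S(w) = D − 1, and the budget leaves
-- excess only at u and w. If w has zero excess, S ⊕ w is stable by hypothesis, which forces
-- d_S(w) ≤ 1 against Δ > 2; otherwise every cut neighbour of u other than w yields the same w, so
-- these are uncut neighbours of w and 2 d_S(w) ≤ d(w), against the positive excess of w.

open import Defs renaming (sym to adj-sym; irrefl to adj-irrefl)
open import Data.Nat using (ℕ; zero; suc; _+_; _*_; _∸_; _≤_; _<_; z≤n; s≤s)
import Data.Nat as ℕ
open import Data.Nat.Properties
  using ( +-*-semiring; +-commutativeSemigroup; +-identityʳ; +-comm; +-assoc
        ; +-mono-≤; +-monoˡ-≤; +-monoʳ-≤; *-monoʳ-≤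
        ; +-cancelˡ-≤; +-cancelʳ-≤; +-cancelʳ-≡; *-cancelˡ-≤
        ; ≤-refl; ≤-reflexive; ≤-trans; ≤-antisym; ≤-pred; <-irrefl; <⇒≱; ≮⇒≥; m<m+n
        ; m≤m+n; m≤n+m; n≤0⇒n≡0; n≢0⇒n>0; m+[n∸m]≡n; 1+n≰n; _<?_
        ; ⊓-sel; m≤m⊔n; m≤n⊔m; module ≤-Reasoning )
open import Data.Nat.Tactic.RingSolver using (solve-∀)
open import Data.Fin using (Fin; zero; suc; _≟_)
open import Data.Fin.Properties using (any?)
open import Data.Bool using (Bool; true; false; if_then_else_; not; _∧_; _∨_; _xor_)
import Data.Bool as Bool
open import Data.Bool.Properties using (∧-inverseˡ; not-distribˡ-xor; not-distribʳ-xor; xor-comm)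
open import Data.Vec.Functional using (updateAt)
open import Data.Vec.Functional.Properties using (updateAt-minimal)
open import Data.Product using (Σ; _×_; _,_; proj₁; proj₂)
open import Data.Sum using (inj₁; inj₂)
open import Data.Empty using (⊥-elim)
open import Function using (_∘_; const)
open import Relation.Nullary using (¬_; contradiction)
open import Relation.Nullary.Decidable using (⌊_⌋; yes; no; _×-dec_)
open import Relation.Binary.PropositionalEquality

open import Algebra.Properties.Semiring.Sum +-*-semiring
  using (sum; sum-cong-≗; ∑-distrib-+; *-distribˡ-sum)
open import Algebra.Properties.CommutativeSemigroup +-commutativeSemigroup using (x∙yz≈y∙xz)

⟦_⟧ : Bool → ℕ
⟦ b ⟧ = if b then 1 else 0

⌊≟⌋-refl : ∀ {n} (i : Fin n) → ⌊ i ≟ i ⌋ ≡ true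
⌊≟⌋-refl i with i ≟ i
... | yes _ = refl
... | no i≢i = contradiction refl i≢i

⌊suc≟suc⌋ : ∀ {n} (i j : Fin n) → ⌊ suc i ≟ suc j ⌋ ≡ ⌊ i ≟ j ⌋
⌊suc≟suc⌋ i j with i ≟ j
... | yes _ = refl
... | no _ = refl

sum-mono-≤ : ∀ {n} {f g : Fin n → ℕ} → (∀ i → f i ≤ g i) → sum f ≤ sum g
sum-mono-≤ {zero} _ = z≤n
sum-mono-≤ {suc n} f≤g = +-mono-≤ (f≤g zero) (sum-mono-≤ (f≤g ∘ suc))

zeroAt : ∀ {n} → (Fin n → ℕ) → Fin n → Fin n → ℕ
zeroAt f a = updateAt f a (const 0)

sum-zeroAt : ∀ {n} (f : Fin n → ℕ) a → sum f ≡ f a + sum (zeroAt f a)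
sum-zeroAt f zero = refl
sum-zeroAt f (suc a) =
  trans (cong (f zero +_) (sum-zeroAt (f ∘ suc) a)) (x∙yz≈y∙xz (f zero) (f (suc a)) _)

zeroAt-≢ : ∀ {n} (f : Fin n → ℕ) {a i} → i ≢ a → zeroAt f a i ≡ f i
zeroAt-≢ f {a} {i} = updateAt-minimal i a f

≤-sum : ∀ {n} (f : Fin n → ℕ) a → f a ≤ sum f
≤-sum f a = ≤-trans (m≤m+n (f a) _) (≤-reflexive (sym (sum-zeroAt f a)))

sum≡0⇒≡0 : ∀ {n} (f : Fin n → ℕ) → sum f ≡ 0 → ∀ i → f i ≡ 0
sum≡0⇒≡0 f sum≡0 i = n≤0⇒n≡0 (≤-trans (≤-sum f i) (≤-reflexive sum≡0))

count≡sum : ∀ {n} (p : Fin n → Bool) → count p ≡ sum (⟦_⟧ ∘ p)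
count≡sum {zero} _ = refl
count≡sum {suc n} p = cong (⟦ p zero ⟧ +_) (count≡sum (p ∘ suc))

count-cong : ∀ {n} {p q : Fin n → Bool} → (∀ i → p i ≡ q i) → count p ≡ count q
count-cong {zero} _ = refl
count-cong {suc n} p≗q = cong₂ (λ b c → ⟦ b ⟧ + c) (p≗q zero) (count-cong (p≗q ∘ suc))

count-false : ∀ {n} → count {n} (const false) ≡ 0
count-false {zero} = refl
count-false {suc n} = count-false {n}

count-mono : ∀ {n} {p q : Fin n → Bool} →
  (∀ i → p i ≡ true → q i ≡ true) → count p ≤ count q
count-mono {zero} _ = z≤n
count-mono {suc n} {p} {q} p⇒q = +-mono-≤ (head (p zero) (q zero) (p⇒q zero)) (count-mono (p⇒q ∘ suc))
  where
  head : ∀ a b → (a ≡ true → b ≡ true) → ⟦ a ⟧ ≤ ⟦ b ⟧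
  head true _ a⇒b rewrite a⇒b refl = ≤-refl
  head false _ _ = z≤n

count-split : ∀ {n} (a b : Fin n → Bool) →
  count (λ i → a i ∧ b i) + count (λ i → a i ∧ not (b i)) ≡ count a
count-split {zero} _ _ = refl
count-split {suc n} a b = begin
  (⟦ a zero ∧ b zero ⟧ + count (λ i → a (suc i) ∧ b (suc i))) +
    (⟦ a zero ∧ not (b zero) ⟧ + count (λ i → a (suc i) ∧ not (b (suc i))))
    ≡⟨ interchange ⟦ a zero ∧ b zero ⟧ _ ⟦ a zero ∧ not (b zero) ⟧ _ ⟩
  (⟦ a zero ∧ b zero ⟧ + ⟦ a zero ∧ not (b zero) ⟧) +
    (count (λ i → a (suc i) ∧ b (suc i)) + count (λ i → a (suc i) ∧ not (b (suc i))))
    ≡⟨ cong₂ _+_ (head (a zero) (b zero)) (count-split (a ∘ suc) (b ∘ suc)) ⟩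
  ⟦ a zero ⟧ + count (a ∘ suc) ∎
  where
  open ≡-Reasoning
  interchange : ∀ w x y z → (w + x) + (y + z) ≡ (w + y) + (x + z)
  interchange = solve-∀
  head : ∀ x y → ⟦ x ∧ y ⟧ + ⟦ x ∧ not y ⟧ ≡ ⟦ x ⟧
  head true true = refl
  head true false = refl
  head false _ = refl

count-∧-≤ : ∀ {n} (a b : Fin n → Bool) → count (λ i → a i ∧ b i) ≤ count a
count-∧-≤ a b = ≤-trans (m≤m+n _ _) (≤-reflexive (count-split a b))

count-∨-≤ : ∀ {n} (a b : Fin n → Bool) → count (λ i → a i ∨ b i) ≤ count a + count b
count-∨-≤ {zero} _ _ = z≤n
count-∨-≤ {suc n} a b = begin
  ⟦ a zero ∨ b zero ⟧ + count (λ i → a (suc i) ∨ b (suc i))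
    ≤⟨ +-mono-≤ (head (a zero) (b zero)) (count-∨-≤ (a ∘ suc) (b ∘ suc)) ⟩
  (⟦ a zero ⟧ + ⟦ b zero ⟧) + (count (a ∘ suc) + count (b ∘ suc))
    ≡⟨ interchange ⟦ a zero ⟧ ⟦ b zero ⟧ _ _ ⟩
  (⟦ a zero ⟧ + count (a ∘ suc)) + (⟦ b zero ⟧ + count (b ∘ suc)) ∎
  where
  open ≤-Reasoning
  interchange : ∀ w x y z → (w + x) + (y + z) ≡ (w + y) + (x + z)
  interchange = solve-∀
  head : ∀ x y → ⟦ x ∨ y ⟧ ≤ ⟦ x ⟧ + ⟦ y ⟧
  head true _ = s≤s z≤n
  head false _ = ≤-refl

count-remove : ∀ {n} (p : Fin n → Bool) v →
  count p ≡ ⟦ p v ⟧ + count (λ j → not ⌊ j ≟ v ⌋ ∧ p j)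
count-remove p zero = refl
count-remove {suc n} p (suc v) = begin
  ⟦ p zero ⟧ + count (p ∘ suc)
    ≡⟨ cong (⟦ p zero ⟧ +_) (count-remove (p ∘ suc) v) ⟩
  ⟦ p zero ⟧ + (⟦ p (suc v) ⟧ + count (λ j → not ⌊ j ≟ v ⌋ ∧ p (suc j)))
    ≡⟨ x∙yz≈y∙xz ⟦ p zero ⟧ ⟦ p (suc v) ⟧ _ ⟩
  ⟦ p (suc v) ⟧ + (⟦ p zero ⟧ + count (λ j → not ⌊ j ≟ v ⌋ ∧ p (suc j)))
    ≡⟨ cong (λ c → ⟦ p (suc v) ⟧ + (⟦ p zero ⟧ + c))
         (count-cong (λ j → cong (λ b → not b ∧ p (suc j)) (sym (⌊suc≟suc⌋ j v)))) ⟩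
  ⟦ p (suc v) ⟧ + count (λ j → not ⌊ j ≟ suc v ⌋ ∧ p j) ∎
  where open ≡-Reasoning

count-≟ : ∀ {n} (v : Fin n) → count (λ j → ⌊ j ≟ v ⌋) ≡ 1
count-≟ {n} v = begin
  count (λ j → ⌊ j ≟ v ⌋)
    ≡⟨ count-remove _ v ⟩
  ⟦ ⌊ v ≟ v ⌋ ⟧ + count (λ j → not ⌊ j ≟ v ⌋ ∧ ⌊ j ≟ v ⌋)
    ≡⟨ cong₂ (λ b c → ⟦ b ⟧ + c) (⌊≟⌋-refl v) (count-cong (∧-inverseˡ ∘ λ j → ⌊ j ≟ v ⌋)) ⟩
  1 + count {n} (const false)
    ≡⟨ cong suc (count-false {n}) ⟩
  1 ∎
  where open ≡-Reasoning

minFin-attained : ∀ {n} (f : Fin n → ℕ) → Fin n → Σ (Fin n) (λ i → f i ≡ minFin f)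
minFin-attained {suc zero} f _ = zero , refl
minFin-attained {suc (suc n)} f _
  with minFin-attained (f ∘ suc) zero | ⊓-sel (f zero) (minFin (f ∘ suc))
... | _ , _ | inj₁ min≡f₀ = zero , sym min≡f₀
... | i , fᵢ≡min | inj₂ min≡rest = suc i , trans fᵢ≡min (sym min≡rest)

≤-maxFin : ∀ {n} (f : Fin n → ℕ) i → f i ≤ maxFin f
≤-maxFin f zero = m≤m⊔n _ _
≤-maxFin f (suc i) = ≤-trans (≤-maxFin (f ∘ suc) i) (m≤n⊔m _ _)

-- The first summand of countPairs {suc n} q, the row of 0 above the diagonal,
-- reduces to count (q zero ∘ suc).
countPairs-cong : ∀ {n} {q r : Fin n → Fin n → Bool} →
  (∀ i j → q i j ≡ r i j) → countPairs q ≡ countPairs r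
countPairs-cong {zero} _ = refl
countPairs-cong {suc n} {q} {r} q≗r =
  cong₂ _+_ (count-cong {p = q zero ∘ suc} {r zero ∘ suc} (q≗r zero ∘ suc))
            (countPairs-cong (λ i j → q≗r (suc i) (suc j)))

handshake : ∀ {n} (q : Fin n → Fin n → Bool) →
  (∀ i j → q i j ≡ q j i) → (∀ i → q i i ≡ false) →
  2 * countPairs q ≡ sum (count ∘ q)
handshake {zero} _ _ _ = refl
handshake {suc n} q q-sym q-irrefl = begin
  2 * (row + countPairs q′)
    ≡⟨ double row (countPairs q′) ⟩
  row + (row + 2 * countPairs q′)
    ≡⟨ cong₂ _+_ row≡count
         (cong₂ _+_ row≡column (handshake q′ (λ i j → q-sym (suc i) (suc j)) (q-irrefl ∘ suc))) ⟩
  count (q zero) + (sum (λ i → ⟦ q (suc i) zero ⟧) + sum (count ∘ q′))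
    ≡⟨ cong (count (q zero) +_) (sym (∑-distrib-+ (λ i → ⟦ q (suc i) zero ⟧) (count ∘ q′))) ⟩
  sum (count ∘ q) ∎
  where
  open ≡-Reasoning
  q′ : Fin n → Fin n → Bool
  q′ i j = q (suc i) (suc j)
  row : ℕ
  row = count (q zero ∘ suc)
  double : ∀ a b → 2 * (a + b) ≡ a + (a + 2 * b)
  double = solve-∀
  row≡count : row ≡ count (q zero)
  row≡count = cong (λ b → ⟦ b ⟧ + row) (sym (q-irrefl zero))
  row≡column : row ≡ sum (λ i → ⟦ q (suc i) zero ⟧)
  row≡column = trans (count-cong (λ i → q-sym zero (suc i))) (count≡sum (λ i → q (suc i) zero))

deleteVertex : ∀ {n} → Fin n → (Fin n → Fin n → Bool) → Fin n → Fin n → Bool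
deleteVertex v q i j = not ⌊ i ≟ v ⌋ ∧ not ⌊ j ≟ v ⌋ ∧ q i j

countPairs-deleteVertex : ∀ {n} (q : Fin n → Fin n → Bool) →
  (∀ i j → q i j ≡ q j i) → (∀ i → q i i ≡ false) →
  ∀ v → countPairs (deleteVertex v q) + count (q v) ≡ countPairs q
countPairs-deleteVertex {suc n} q _ q-irrefl zero = begin
  count {n} (const false) + countPairs q′ + count (q zero)
    ≡⟨ cong₂ (λ c b → c + countPairs q′ + (⟦ b ⟧ + count (q zero ∘ suc)))
         (count-false {n}) (q-irrefl zero) ⟩
  countPairs q′ + count (q zero ∘ suc)
    ≡⟨ +-comm (countPairs q′) _ ⟩
  count (q zero ∘ suc) + countPairs q′ ∎
  where
  open ≡-Reasoning
  q′ : Fin n → Fin n → Bool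
  q′ i j = q (suc i) (suc j)
countPairs-deleteVertex {suc n} q q-sym q-irrefl (suc v) = begin
  count (λ j → not ⌊ suc j ≟ suc v ⌋ ∧ q zero (suc j))
    + countPairs (λ i j → deleteVertex (suc v) q (suc i) (suc j)) + count (q (suc v))
    ≡⟨ cong₂ (λ r p → r + p + count (q (suc v)))
         (count-cong (λ j → cong (λ b → not b ∧ q zero (suc j)) (⌊suc≟suc⌋ j v)))
         (countPairs-cong (λ i j →
           cong₂ (λ b c → not b ∧ not c ∧ q′ i j) (⌊suc≟suc⌋ i v) (⌊suc≟suc⌋ j v))) ⟩
  rowᵥ + countPairs (deleteVertex v q′) + (⟦ q (suc v) zero ⟧ + count (q′ v))
    ≡⟨ interchange rowᵥ _ ⟦ q (suc v) zero ⟧ _ ⟩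
  (⟦ q (suc v) zero ⟧ + rowᵥ) + (countPairs (deleteVertex v q′) + count (q′ v))
    ≡⟨ cong₂ _+_
         (trans (cong (λ b → ⟦ b ⟧ + rowᵥ) (q-sym (suc v) zero)) (sym (count-remove (q zero ∘ suc) v)))
         (countPairs-deleteVertex q′ (λ i j → q-sym (suc i) (suc j)) (q-irrefl ∘ suc) v) ⟩
  count (q zero ∘ suc) + countPairs q′ ∎
  where
  open ≡-Reasoning
  q′ : Fin n → Fin n → Bool
  q′ i j = q (suc i) (suc j)
  rowᵥ : ℕ
  rowᵥ = count (λ j → not ⌊ j ≟ v ⌋ ∧ q zero (suc j))
  interchange : ∀ a b c d → a + b + (c + d) ≡ (c + a) + (b + d)
  interchange = solve-∀

⊕-self : ∀ {n} (S : Cut n) v → (S ⊕ v) v ≡ not (S v)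
⊕-self S v rewrite ⌊≟⌋-refl v = refl

⊕-other : ∀ {n} (S : Cut n) {v w} → w ≢ v → (S ⊕ v) w ≡ S w
⊕-other S {v} {w} w≢v with w ≟ v
... | yes w≡v = contradiction w≡v w≢v
... | no _ = refl

module _ {n : ℕ} (G : Graph n) where

  cutEdge : Cut n → Fin n → Fin n → Bool
  cutEdge S i j = adj G i j ∧ (S i xor S j)

  uncutEdge : Cut n → Fin n → Fin n → Bool
  uncutEdge S i j = adj G i j ∧ not (S i xor S j)

  cutEdge-sym : ∀ S i j → cutEdge S i j ≡ cutEdge S j i
  cutEdge-sym S i j = cong₂ _∧_ (adj-sym G i j) (xor-comm (S i) (S j))

  cutEdge-irrefl : ∀ S i → cutEdge S i i ≡ false
  cutEdge-irrefl S i = cong (_∧ (S i xor S i)) (adj-irrefl G i)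

  cutEdge⇒≢ : ∀ S {i j} → cutEdge S i j ≡ true → i ≢ j
  cutEdge⇒≢ S {i} cut refl = contradiction (trans (sym (cutEdge-irrefl S i)) cut) λ ()

  cutEdge⇒opposite : ∀ S {i j} → cutEdge S i j ≡ true → S j ≡ not (S i)
  cutEdge⇒opposite S {i} {j} cut with adj G i j | S i | S j
  ... | true | true | false = refl
  ... | true | false | true = refl
  ... | true | true | true = contradiction cut λ ()
  ... | true | false | false = contradiction cut λ ()
  ... | false | _ | _ = contradiction cut λ ()

  cutEdge⇒¬uncutEdge : ∀ S {i j} → cutEdge S i j ≡ true → uncutEdge S i j ≡ false
  cutEdge⇒¬uncutEdge S {i} {j} cut with adj G i j | S i xor S j
  ... | true | true = refl
  ... | true | false = contradiction cut λ ()
  ... | false | _ = refl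

  uncutEdge⇒same : ∀ S {i j} → uncutEdge S i j ≡ true → S i ≡ S j
  uncutEdge⇒same S {i} {j} uncut with adj G i j | S i | S j
  ... | true | true | true = refl
  ... | true | false | false = refl
  ... | true | true | false = contradiction uncut λ ()
  ... | true | false | true = contradiction uncut λ ()
  ... | false | _ | _ = contradiction uncut λ ()

  degCut+uncut≡deg : ∀ S v → degCut G S v + count (uncutEdge S v) ≡ deg G v
  degCut+uncut≡deg S v = count-split (adj G v) (λ j → S v xor S j)

  degCut≤deg : ∀ S v → degCut G S v ≤ deg G v
  degCut≤deg S v = count-∧-≤ (adj G v) (λ j → S v xor S j)

  2*edges≡sum-deg : 2 * edges G ≡ sum (deg G)
  2*edges≡sum-deg = handshake (adj G) (adj-sym G) (adj-irrefl G)

  2*cutSize≡sum-degCut : ∀ S → 2 * cutSize G S ≡ sum (degCut G S)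
  2*cutSize≡sum-degCut S = handshake (cutEdge S) (cutEdge-sym S) (cutEdge-irrefl S)

  cutSizeWithout+degCut : ∀ S v → cutSizeWithout G S v + degCut G S v ≡ cutSize G S
  cutSizeWithout+degCut S = countPairs-deleteVertex (cutEdge S) (cutEdge-sym S) (cutEdge-irrefl S)

  critical-exists : ∀ S → Fin n → Σ (Fin n) (Critical G S)
  critical-exists S = minFin-attained (cutSizeWithout G S)

  φ+degCut-critical : ∀ S u → Critical G S u → φ G S + degCut G S u ≡ cutSize G S
  φ+degCut-critical S u crit = trans (cong (_+ degCut G S u) (sym crit)) (cutSizeWithout+degCut S u)

  degCut-⊕-self : ∀ S v → degCut G (S ⊕ v) v ≡ count (uncutEdge S v)
  degCut-⊕-self S v = count-cong flipped
    where
    flipped : ∀ x → cutEdge (S ⊕ v) v x ≡ uncutEdge S v x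
    flipped x with x ≟ v
    ... | yes refl rewrite adj-irrefl G x = refl
    ... | no _ = cong (adj G v x ∧_)
      (trans (cong (_xor S x) (⊕-self S v)) (sym (not-distribˡ-xor (S v) (S x))))

  ZeroExcess⇒degCut-⊕-self : ∀ S v → ZeroExcess G S v → degCut G (S ⊕ v) v ≡ degCut G S v
  ZeroExcess⇒degCut-⊕-self S v zero-excess = +-cancelʳ-≡ (degCut G S v) _ _ (begin
    degCut G (S ⊕ v) v + degCut G S v            ≡⟨ cong (_+ degCut G S v) (degCut-⊕-self S v) ⟩
    count (uncutEdge S v) + degCut G S v         ≡⟨ +-comm _ (degCut G S v) ⟩
    degCut G S v + count (uncutEdge S v)         ≡⟨ degCut+uncut≡deg S v ⟩
    deg G v                                      ≡⟨ sym zero-excess ⟩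
    2 * degCut G S v                             ≡⟨ cong (degCut G S v +_) (+-identityʳ (degCut G S v)) ⟩
    degCut G S v + degCut G S v                  ∎)
    where open ≡-Reasoning

  degCut-⊕ : ∀ S {v w} → w ≢ v →
    degCut G (S ⊕ v) w + ⟦ cutEdge S w v ⟧ ≡ degCut G S w + ⟦ uncutEdge S w v ⟧
  degCut-⊕ S {v} {w} w≢v = begin
    degCut G (S ⊕ v) w + ⟦ cutEdge S w v ⟧
      ≡⟨ cong (_+ ⟦ cutEdge S w v ⟧) (count-remove (cutEdge (S ⊕ v) w) v) ⟩
    ⟦ cutEdge (S ⊕ v) w v ⟧ + others (S ⊕ v) + ⟦ cutEdge S w v ⟧
      ≡⟨ cong₂ (λ b r → ⟦ b ⟧ + r + ⟦ cutEdge S w v ⟧) flipped (count-cong unchanged) ⟩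
    ⟦ uncutEdge S w v ⟧ + others S + ⟦ cutEdge S w v ⟧
      ≡⟨ swap ⟦ uncutEdge S w v ⟧ (others S) ⟦ cutEdge S w v ⟧ ⟩
    ⟦ cutEdge S w v ⟧ + others S + ⟦ uncutEdge S w v ⟧
      ≡⟨ cong (_+ ⟦ uncutEdge S w v ⟧) (count-remove (cutEdge S w) v) ⟨
    degCut G S w + ⟦ uncutEdge S w v ⟧ ∎
    where
    open ≡-Reasoning
    others : Cut n → ℕ
    others T = count (λ j → not ⌊ j ≟ v ⌋ ∧ cutEdge T w j)
    swap : ∀ a r b → a + r + b ≡ b + r + a
    swap = solve-∀
    flipped : cutEdge (S ⊕ v) w v ≡ uncutEdge S w v
    flipped = cong (adj G w v ∧_)
      (trans (cong₂ _xor_ (⊕-other S w≢v) (⊕-self S v)) (sym (not-distribʳ-xor (S w) (S v))))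
    unchanged : ∀ j → (not ⌊ j ≟ v ⌋ ∧ cutEdge (S ⊕ v) w j) ≡ (not ⌊ j ≟ v ⌋ ∧ cutEdge S w j)
    unchanged j with j ≟ v
    ... | yes _ = refl
    ... | no _ = cong (λ s → adj G w j ∧ (s xor S j)) (⊕-other S w≢v)

  degCut-⊕-cutEdge : ∀ S {v w} → cutEdge S w v ≡ true → degCut G (S ⊕ v) w + 1 ≡ degCut G S w
  degCut-⊕-cutEdge S {v} {w} cut = begin
    degCut G (S ⊕ v) w + 1
      ≡⟨ cong (λ b → degCut G (S ⊕ v) w + ⟦ b ⟧) cut ⟨
    degCut G (S ⊕ v) w + ⟦ cutEdge S w v ⟧
      ≡⟨ degCut-⊕ S (cutEdge⇒≢ S cut) ⟩
    degCut G S w + ⟦ uncutEdge S w v ⟧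
      ≡⟨ cong (λ b → degCut G S w + ⟦ b ⟧) (cutEdge⇒¬uncutEdge S cut) ⟩
    degCut G S w + 0
      ≡⟨ +-identityʳ _ ⟩
    degCut G S w ∎
    where open ≡-Reasoning

  degCut-⊕-≤ : ∀ S {v w} → w ≢ v → degCut G (S ⊕ v) w ≤ degCut G S w + ⟦ uncutEdge S w v ⟧
  degCut-⊕-≤ S w≢v = ≤-trans (m≤m+n _ _) (≤-reflexive (degCut-⊕ S w≢v))

  cutSizeWithout-⊕-self : ∀ S v → cutSizeWithout G (S ⊕ v) v ≡ cutSizeWithout G S v
  cutSizeWithout-⊕-self S v = countPairs-cong unchanged
    where
    unchanged : ∀ i j → deleteVertex v (cutEdge (S ⊕ v)) i j ≡ deleteVertex v (cutEdge S) i j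
    unchanged i j with i ≟ v | j ≟ v
    ... | yes _ | _ = refl
    ... | no _ | yes _ = refl
    ... | no _ | no _ = refl

  cutSize-⊕ : ∀ S v → ZeroExcess G S v → cutSize G (S ⊕ v) ≡ cutSize G S
  cutSize-⊕ S v zero-excess = begin
    cutSize G (S ⊕ v)
      ≡⟨ cutSizeWithout+degCut (S ⊕ v) v ⟨
    cutSizeWithout G (S ⊕ v) v + degCut G (S ⊕ v) v
      ≡⟨ cong₂ _+_ (cutSizeWithout-⊕-self S v) (ZeroExcess⇒degCut-⊕-self S v zero-excess) ⟩
    cutSizeWithout G S v + degCut G S v
      ≡⟨ cutSizeWithout+degCut S v ⟩
    cutSize G S ∎
    where open ≡-Reasoning

  -- Twice the excess x_S(v) of the paper, truncated at 0; the truncation is invisible on stable cuts.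
  excess : Cut n → Fin n → ℕ
  excess S v = 2 * degCut G S v ∸ deg G v

  deg+excess : ∀ S → Stable G S → ∀ v → deg G v + excess S v ≡ 2 * degCut G S v
  deg+excess S stable v = m+[n∸m]≡n (≤-pred (subst (deg G v <_) (+-comm _ 1) (stable v)))

  excess≡0⇒ZeroExcess : ∀ S → Stable G S → ∀ v → excess S v ≡ 0 → ZeroExcess G S v
  excess≡0⇒ZeroExcess S stable v excess≡0 =
    trans (sym (deg+excess S stable v)) (trans (cong (deg G v +_) excess≡0) (+-identityʳ _))

  4*cutSize≡2*edges+sum-excess : ∀ S → Stable G S →
    2 * (2 * cutSize G S) ≡ 2 * edges G + sum (excess S)
  4*cutSize≡2*edges+sum-excess S stable = begin
    2 * (2 * cutSize G S)              ≡⟨ cong (2 *_) (2*cutSize≡sum-degCut S) ⟩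
    2 * sum (degCut G S)               ≡⟨ *-distribˡ-sum 2 (degCut G S) ⟩
    sum (λ v → 2 * degCut G S v)       ≡⟨ sum-cong-≗ (λ v → sym (deg+excess S stable v)) ⟩
    sum (λ v → deg G v + excess S v)   ≡⟨ ∑-distrib-+ (deg G) (excess S) ⟩
    sum (deg G) + sum (excess S)       ≡⟨ cong (_+ sum (excess S)) 2*edges≡sum-deg ⟨
    2 * edges G + sum (excess S)       ∎
    where open ≡-Reasoning

  ZeroExcess⇒⊕-unstable : ∀ S {v y} → ZeroExcess G S y → cutEdge S y v ≡ true →
    ¬ (deg G y < 2 * degCut G (S ⊕ v) y + 1)
  ZeroExcess⇒⊕-unstable S {v} {y} zero-excess cut stable-at-y = <⇒≱ stable-at-y (begin
    2 * degCut G (S ⊕ v) y + 1          ≤⟨ m≤m+n _ 1 ⟩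
    2 * degCut G (S ⊕ v) y + 1 + 1      ≡⟨ double-suc (degCut G (S ⊕ v) y) ⟩
    2 * (degCut G (S ⊕ v) y + 1)        ≡⟨ cong (2 *_) (degCut-⊕-cutEdge S cut) ⟩
    2 * degCut G S y                    ≡⟨ zero-excess ⟩
    deg G y                             ∎)
    where
    open ≤-Reasoning
    double-suc : ∀ c → 2 * c + 1 + 1 ≡ 2 * (c + 1)
    double-suc = solve-∀

  module _ {S : Cut n} {u : Fin n}
           (stable : Stable G S) (small : PhiSmall G S) (critical : Critical G S u) where

    private
      D Δ excessOff : ℕ
      D = degCut G S u
      Δ = maxDeg G
      excessOff = sum (zeroAt (excess S) u)

      D≤Δ : D ≤ Δ
      D≤Δ = ≤-trans (degCut≤deg S u) (≤-maxFin (deg G) u)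

      2*suc : ∀ c → 2 * suc c ≡ 2 * c + 2
      2*suc = solve-∀

    RunnerUp : Fin n → Set
    RunnerUp w = suc (degCut G S w) ≡ degCut G S u

    runnerUp⇒≢u : ∀ {w} → RunnerUp w → w ≢ u
    runnerUp⇒≢u runnerUp refl = 1+n≰n (≤-reflexive runnerUp)

    excess-budget : sum (zeroAt (excess S) u) + maxDeg G + 2 ≤ 2 * degCut G S u
    excess-budget = +-cancelˡ-≤ (2 * (2 * φ G S) + Δ + excess S u) _ _ (begin
      2 * (2 * φ G S) + Δ + excess S u + (excessOff + Δ + 2)
        ≡⟨ regroup₁ (φ G S) Δ (excess S u) excessOff ⟩
      2 * suc (2 * φ G S + Δ) + (excess S u + excessOff)
        ≤⟨ +-monoˡ-≤ _ (*-monoʳ-≤ 2 small) ⟩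
      2 * edges G + (excess S u + excessOff)
        ≡⟨ cong (2 * edges G +_) (sum-zeroAt (excess S) u) ⟨
      2 * edges G + sum (excess S)
        ≡⟨ 4*cutSize≡2*edges+sum-excess S stable ⟨
      2 * (2 * cutSize G S)
        ≡⟨ cong (λ C → 2 * (2 * C)) (φ+degCut-critical S u critical) ⟨
      2 * (2 * (φ G S + D))
        ≡⟨ regroup₂ (φ G S) D ⟩
      2 * (2 * φ G S) + 2 * D + 2 * D
        ≡⟨ cong (2 * (2 * φ G S) + 2 * D +_) (deg+excess S stable u) ⟨
      2 * (2 * φ G S) + 2 * D + (deg G u + excess S u)
        ≤⟨ +-monoʳ-≤ (2 * (2 * φ G S) + 2 * D) (+-monoˡ-≤ (excess S u) (≤-maxFin (deg G) u)) ⟩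
      2 * (2 * φ G S) + 2 * D + (Δ + excess S u)
        ≡⟨ regroup₃ (2 * (2 * φ G S)) (2 * D) Δ (excess S u) ⟩
      2 * (2 * φ G S) + Δ + excess S u + 2 * D ∎)
      where
      open ≤-Reasoning
      regroup₁ : ∀ p d e E → 2 * (2 * p) + d + e + (E + d + 2) ≡ 2 * suc (2 * p + d) + (e + E)
      regroup₁ = solve-∀
      regroup₂ : ∀ p c → 2 * (2 * (p + c)) ≡ 2 * (2 * p) + 2 * c + 2 * c
      regroup₂ = solve-∀
      regroup₃ : ∀ a b d e → a + b + (d + e) ≡ a + d + e + b
      regroup₃ = solve-∀

    excessOff<degCut : sum (zeroAt (excess S) u) < degCut G S u
    excessOff<degCut = +-cancelʳ-≤ D (suc excessOff) D (begin
      suc (excessOff + D)      ≤⟨ s≤s (+-monoʳ-≤ excessOff D≤Δ) ⟩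
      suc (excessOff + Δ)      ≤⟨ m≤n+m _ 1 ⟩
      2 + (excessOff + Δ)      ≡⟨ +-comm 2 _ ⟩
      excessOff + Δ + 2        ≤⟨ excess-budget ⟩
      2 * D                    ≡⟨ cong (D +_) (+-identityʳ D) ⟩
      D + D                    ∎)
      where open ≤-Reasoning

    maxDeg+2≤2*degCut : maxDeg G + 2 ≤ 2 * degCut G S u
    maxDeg+2≤2*degCut =
      ≤-trans (m≤n+m (Δ + 2) excessOff)
              (≤-trans (≤-reflexive (sym (+-assoc excessOff Δ 2))) excess-budget)

    excess≤excessOff : ∀ {w} → w ≢ u → excess S w ≤ sum (zeroAt (excess S) u)
    excess≤excessOff {w} w≢u =
      ≤-trans (≤-reflexive (sym (zeroAt-≢ (excess S) w≢u))) (≤-sum (zeroAt (excess S) u) w)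

    degCut<critical : ∀ {w} → w ≢ u → degCut G S w < degCut G S u
    degCut<critical {w} w≢u = *-cancelˡ-≤ 2 (begin
      2 * suc (degCut G S w)           ≡⟨ 2*suc (degCut G S w) ⟩
      2 * degCut G S w + 2             ≡⟨ cong (_+ 2) (deg+excess S stable w) ⟨
      deg G w + excess S w + 2
        ≤⟨ +-monoˡ-≤ 2 (+-mono-≤ (≤-maxFin (deg G) w) (excess≤excessOff w≢u)) ⟩
      Δ + excessOff + 2                ≡⟨ cong (_+ 2) (+-comm Δ excessOff) ⟩
      excessOff + Δ + 2                ≤⟨ excess-budget ⟩
      2 * D                            ∎)
      where open ≤-Reasoning

    -- A runner-up already spends the whole budget on its own excess.
    excessOff-runnerUp≡0 : ∀ {w} → RunnerUp w → sum (zeroAt (zeroAt (excess S) u) w) ≡ 0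
    excessOff-runnerUp≡0 {w} runnerUp = n≤0⇒n≡0 (+-cancelˡ-≤ (exw + Δ + 2) _ _ (begin
      exw + Δ + 2 + rest                     ≡⟨ regroup exw rest Δ ⟨
      exw + rest + Δ + 2                     ≡⟨ cong (λ E → E + Δ + 2) excessOff-split ⟨
      excessOff + Δ + 2                      ≤⟨ excess-budget ⟩
      2 * D                                  ≡⟨ cong (2 *_) runnerUp ⟨
      2 * suc (degCut G S w)                 ≡⟨ 2*suc (degCut G S w) ⟩
      2 * degCut G S w + 2                   ≡⟨ cong (_+ 2) (deg+excess S stable w) ⟨
      deg G w + exw + 2                      ≤⟨ +-monoˡ-≤ 2 (+-monoˡ-≤ exw (≤-maxFin (deg G) w)) ⟩
      Δ + exw + 2                            ≡⟨ cong (_+ 2) (+-comm Δ exw) ⟩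
      exw + Δ + 2                            ≡⟨ +-identityʳ _ ⟨
      exw + Δ + 2 + 0                        ∎))
      where
      open ≤-Reasoning
      exw = excess S w
      rest = sum (zeroAt (zeroAt (excess S) u) w)
      excessOff-split : excessOff ≡ exw + rest
      excessOff-split = trans (sum-zeroAt (zeroAt (excess S) u) w)
                              (cong (_+ rest) (zeroAt-≢ (excess S) (runnerUp⇒≢u runnerUp)))
      regroup : ∀ e R d → e + R + d + 2 ≡ e + d + 2 + R
      regroup = solve-∀

    excess≡0-off-runnerUp : ∀ {w} → RunnerUp w → ∀ {x} → x ≢ u → x ≢ w → excess S x ≡ 0
    excess≡0-off-runnerUp {w} runnerUp {x} x≢u x≢w = begin
      excess S x                          ≡⟨ zeroAt-≢ (excess S) x≢u ⟨
      zeroAt (excess S) u x               ≡⟨ zeroAt-≢ (zeroAt (excess S) u) x≢w ⟨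
      zeroAt (zeroAt (excess S) u) w x    ≡⟨ sum≡0⇒≡0 _ (excessOff-runnerUp≡0 runnerUp) x ⟩
      0                                   ∎
      where open ≡-Reasoning

    zeroExcess-cutNeighbour : Σ (Fin n) (λ v → cutEdge S u v ≡ true × excess S v ≡ 0)
    zeroExcess-cutNeighbour with any? (λ v → (cutEdge S u v Bool.≟ true) ×-dec (excess S v ℕ.≟ 0))
    ... | yes found = found
    ... | no none = contradiction D≤excessOff (<⇒≱ excessOff<degCut)
      where
      cutNeighbour-has-excess : ∀ x → ⟦ cutEdge S u x ⟧ ≤ zeroAt (excess S) u x
      cutNeighbour-has-excess x with cutEdge S u x in cut
      ... | false = z≤n
      ... | true = ≤-trans (n≢0⇒n>0 (λ excess≡0 → none (x , cut , excess≡0)))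
                           (≤-reflexive (sym (zeroAt-≢ (excess S) (≢-sym (cutEdge⇒≢ S cut)))))
      D≤excessOff : D ≤ excessOff
      D≤excessOff =
        ≤-trans (≤-reflexive (count≡sum (cutEdge S u))) (sum-mono-≤ cutNeighbour-has-excess)

    -- Flipping a runner-up w makes its cut neighbours other than u unstable (they have zero excess),
    -- so in a stable S ⊕ w it has at most one cut edge, against 2 d_S(u) ≥ Δ + 2 > 4.
    ¬stable-⊕-runnerUp : ∀ {w} → RunnerUp w → 2 < maxDeg G → ¬ Stable G (S ⊕ w)
    ¬stable-⊕-runnerUp {w} runnerUp 2<Δ stable′ = <⇒≱ 2<Δ (+-cancelʳ-≤ 2 Δ 2 (begin
      Δ + 2                       ≤⟨ maxDeg+2≤2*degCut ⟩
      2 * D                       ≡⟨ cong (2 *_) runnerUp ⟨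
      2 * suc (degCut G S w)      ≤⟨ *-monoʳ-≤ 2 (s≤s degCut≤1) ⟩
      4                           ∎))
      where
      open ≤-Reasoning
      only-u : ∀ y → cutEdge S w y ≡ true → ⌊ y ≟ u ⌋ ≡ true
      only-u y cut with y ≟ u
      ... | yes _ = refl
      ... | no y≢u = contradiction (stable′ y) (ZeroExcess⇒⊕-unstable S
          (excess≡0⇒ZeroExcess S stable y
            (excess≡0-off-runnerUp runnerUp y≢u (≢-sym (cutEdge⇒≢ S cut))))
          (trans (cutEdge-sym S y w) cut))
      degCut≤1 : degCut G S w ≤ 1
      degCut≤1 = ≤-trans (count-mono only-u) (≤-reflexive (count-≟ u))

    module _ (u∈S : S u ≡ true) (noGain : ∀ v → ZeroExcess G S v → φ G (S ⊕ v) ≤ φ G S) where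

      -- The critical vertex of S ⊕ v, for a zero-excess cut neighbour v of u.
      record Partner (v : Fin n) : Set where
        field
          vertex : Fin n
          vertex∉S : S vertex ≡ false
          uncut : uncutEdge S vertex v ≡ true
          runnerUp : RunnerUp vertex

      partner : ∀ {v} → cutEdge S u v ≡ true → excess S v ≡ 0 → Partner v
      partner {v} cut excess≡0 = record
        { vertex = w ; vertex∉S = w∉S ; uncut = uncut ; runnerUp = runnerUp }
        where
        zero-excess : ZeroExcess G S v
        zero-excess = excess≡0⇒ZeroExcess S stable v excess≡0
        v∉S : S v ≡ false
        v∉S = trans (cutEdge⇒opposite S cut) (cong not u∈S)
        w : Fin n
        w = proj₁ (critical-exists (S ⊕ v) u)
        w-critical : Critical G (S ⊕ v) w
        w-critical = proj₂ (critical-exists (S ⊕ v) u)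
        D≤degCut′ : D ≤ degCut G (S ⊕ v) w
        D≤degCut′ = +-cancelˡ-≤ (φ G (S ⊕ v)) _ _ (begin
          φ G (S ⊕ v) + D                    ≤⟨ +-monoˡ-≤ D (noGain v zero-excess) ⟩
          φ G S + D                          ≡⟨ φ+degCut-critical S u critical ⟩
          cutSize G S                        ≡⟨ cutSize-⊕ S v zero-excess ⟨
          cutSize G (S ⊕ v)                  ≡⟨ φ+degCut-critical (S ⊕ v) w w-critical ⟨
          φ G (S ⊕ v) + degCut G (S ⊕ v) w   ∎)
          where open ≤-Reasoning
        w≢u : w ≢ u
        w≢u w≡u = 1+n≰n (≤-trans (≤-reflexive (trans (+-comm 1 _) (degCut-⊕-cutEdge S cut)))
                                  (subst (λ x → D ≤ degCut G (S ⊕ v) x) w≡u D≤degCut′))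
        w≢v : w ≢ v
        w≢v w≡v = <⇒≱ (degCut<critical (≢-sym (cutEdge⇒≢ S cut)))
                      (≤-trans (subst (λ x → D ≤ degCut G (S ⊕ v) x) w≡v D≤degCut′)
                               (≤-reflexive (ZeroExcess⇒degCut-⊕-self S v zero-excess)))
        bound : suc (degCut G S w) ≤ degCut G S w + ⟦ uncutEdge S w v ⟧
        bound = ≤-trans (degCut<critical w≢u) (≤-trans D≤degCut′ (degCut-⊕-≤ S w≢v))
        uncut : uncutEdge S w v ≡ true
        uncut with uncutEdge S w v | bound
        ... | true | _ = refl
        ... | false | suc≤ = contradiction (≤-trans suc≤ (≤-reflexive (+-identityʳ _))) 1+n≰n
        runnerUp : RunnerUp w
        runnerUp = ≤-antisym (degCut<critical w≢u) (begin
          D                                       ≤⟨ D≤degCut′ ⟩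
          degCut G (S ⊕ v) w                      ≤⟨ degCut-⊕-≤ S w≢v ⟩
          degCut G S w + ⟦ uncutEdge S w v ⟧      ≡⟨ cong (λ b → degCut G S w + ⟦ b ⟧) uncut ⟩
          degCut G S w + 1                        ≡⟨ +-comm _ 1 ⟩
          suc (degCut G S w)                      ∎)
          where open ≤-Reasoning
        w∉S : S w ≡ false
        w∉S = trans (uncutEdge⇒same S uncut) v∉S

      -- Every other cut neighbour of u has w as its partner too and is therefore an uncut neighbour
      -- of w; counting these, excess w > 0 would give 2 d_S(w) ≤ d(w).
      partner-excess≡0 : ∀ {v} (p : Partner v) → excess S (Partner.vertex p) ≡ 0
      partner-excess≡0 p with excess S (Partner.vertex p) ℕ.≟ 0
      ... | yes excess≡0 = excess≡0
      ... | no excess≢0 = ⊥-elim (<-irrefl refl (begin-strict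
          deg G w                             <⟨ m<m+n (deg G w) (n≢0⇒n>0 excess≢0) ⟩
          deg G w + excess S w                ≡⟨ deg+excess S stable w ⟩
          degCut G S w + (degCut G S w + 0)     ≡⟨ cong (degCut G S w +_) (+-identityʳ _) ⟩
          degCut G S w + degCut G S w           ≤⟨ +-monoʳ-≤ (degCut G S w) degCut≤uncut ⟩
          degCut G S w + count (uncutEdge S w)  ≡⟨ degCut+uncut≡deg S w ⟩
          deg G w                               ∎))
        where
        open ≤-Reasoning
        open Partner p renaming (vertex to w)
        uncut-to-w : ∀ {y} → Partner y → uncutEdge S w y ≡ true
        uncut-to-w q with Partner.vertex q ≟ w
        ... | yes refl = Partner.uncut q
        ... | no q≢w = contradiction
          (excess≡0-off-runnerUp (Partner.runnerUp q) (runnerUp⇒≢u runnerUp) (≢-sym q≢w)) excess≢0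
        w-or-uncut : ∀ y → cutEdge S u y ≡ true → (⌊ y ≟ w ⌋ ∨ uncutEdge S w y) ≡ true
        w-or-uncut y cut with y ≟ w
        ... | yes _ = refl
        ... | no y≢w =
          uncut-to-w (partner cut (excess≡0-off-runnerUp runnerUp (≢-sym (cutEdge⇒≢ S cut)) y≢w))
        degCut≤uncut : degCut G S w ≤ count (uncutEdge S w)
        degCut≤uncut = ≤-pred (begin
          suc (degCut G S w)
            ≡⟨ runnerUp ⟩
          count (cutEdge S u)
            ≤⟨ count-mono w-or-uncut ⟩
          count (λ y → ⌊ y ≟ w ⌋ ∨ uncutEdge S w y)
            ≤⟨ count-∨-≤ (λ y → ⌊ y ≟ w ⌋) (uncutEdge S w) ⟩
          count (λ y → ⌊ y ≟ w ⌋) + count (uncutEdge S w)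
            ≡⟨ cong (_+ count (uncutEdge S w)) (count-≟ w) ⟩
          suc (count (uncutEdge S w)) ∎)

    ¬noGain : S u ≡ true → 2 < maxDeg G →
      (∀ w → S w ≡ false → ZeroExcess G S w → Stable G (S ⊕ w)) →
      ¬ (∀ v → ZeroExcess G S v → φ G (S ⊕ v) ≤ φ G S)
    ¬noGain u∈S 2<Δ flipStable noGain =
      let (_ , cut , excess≡0) = zeroExcess-cutNeighbour
          p = partner u∈S noGain cut excess≡0
          open Partner p
          vertex-zeroExcess = excess≡0⇒ZeroExcess S stable vertex (partner-excess≡0 u∈S noGain p)
      in ¬stable-⊕-runnerUp runnerUp 2<Δ (flipStable vertex vertex∉S vertex-zeroExcess)

lemma27 : {n : ℕ} (G : Graph n) (S : Cut n) (u : Fin n) →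
    2 < maxDeg G →
    Stable G S →
    PhiSmall G S →
    Critical G S u →
    S u ≡ true →
    ((w : Fin n) → S w ≡ false → ZeroExcess G S w →
      Stable G (S ⊕ w) × PhiSmall G (S ⊕ w)) →
    Σ (Fin n) (λ v → ZeroExcess G S v × φ G S < φ G (S ⊕ v))
lemma27 G S u 2<Δ stable small critical u∈S flipGood
  with any? (λ v → (2 * degCut G S v ℕ.≟ deg G v) ×-dec (φ G S <? φ G (S ⊕ v)))
... | yes gain = gain
... | no noGain = ⊥-elim (¬noGain G stable small critical u∈S 2<Δ
                            (λ w w∉S zero-excess → proj₁ (flipGood w w∉S zero-excess))
                            (λ v zero-excess → ≮⇒≥ (λ gain → noGain (v , zero-excess , gain))))
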